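{- Let $T$ be a $t$-norm, $S$ a $t$-conorm and $N$ a crisp fuzzy negation, and let $I_{S,N,T}(x,y)=S(N(T(x,N(y))),N(x))$ for $x,y\in[0,1]$. Then: (i) $I_{S,N,T}$ satisfies (EP); (ii) $I_{S,N,T}$ does not satisfy (NP); (iii) $I_{S,N,T}$ satisfies (IP); (iv) $I_{S,N,T}$ satisfies (LOP); (v) $I_{S,N,T}$ does not satisfy (ROP); (vi) $I_{S,N,T}$ does not satisfy (OP).
   Context: A $t$-norm is a function $T:[0,1]^2\to[0,1]$ that is commutative, associative, non-decreasing in each argument and satisfies $T(x,1)=x$. A $t$-conorm is a function $S:[0,1]^2\to[0,1]$ that is commutative, associative, non-decreasing in each argument and satisfies $S(x,0)=x$. A fuzzy negation is a non-increasing $N:[0,1]\to[0,1]$ with $N(0)=1$, $N(1)=0$; it is crisp if $N(x)\in\{0,1\}$ for all $x$. For $I:[0,1]^2\to[0,1]$: (EP) means $I(x,I(y,z))=I(y,I(x,z))$ for all $x,y,z$; (NP) means $I(1,y)=y$ for all $y$; (IP) means $I(x,x)=1$ for all $x$; (LOP) means $x\le y\Rightarrow I(x,y)=1$; (ROP) means $I(x,y)=1\Rightarrow x\le y$; (OP) means $I(x,y)=1\iff x\le y$ (i.e. both (LOP) and (ROP)). -}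

module Defs where

open import Level using (0ℓ)
open import Data.Product using (Σ; ∃; _×_; _,_)
open import Data.Sum using (_⊎_)
open import Relation.Nullary using (¬_)
open import Relation.Binary.PropositionalEquality using (_≡_; _≢_)

-- The real numbers, axiomatised as a complete ordered field
-- (unique up to isomorphism, so quantifying over all models is the
-- same as speaking about ℝ).  Equality is propositional equality.
record RealField : Set₁ where
  infixl 6 _+_
  infixl 7 _*_
  infix 4 _≤_
  field
    ℝ     : Set
    0ℝ 1ℝ : ℝ
    _+_ _*_ : ℝ → ℝ → ℝ
    -_    : ℝ → ℝ
    _⁻¹   : ℝ → ℝ
    _≤_   : ℝ → ℝ → Set
    +-assoc    : ∀ x y z → (x + y) + z ≡ x + (y + z)
    +-comm     : ∀ x y → x + y ≡ y + x
    +-identity : ∀ x → x + 0ℝ ≡ x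
    +-inverse  : ∀ x → x + (- x) ≡ 0ℝ
    *-assoc    : ∀ x y z → (x * y) * z ≡ x * (y * z)
    *-comm     : ∀ x y → x * y ≡ y * x
    *-identity : ∀ x → x * 1ℝ ≡ x
    *-inverse  : ∀ x → x ≢ 0ℝ → x * (x ⁻¹) ≡ 1ℝ
    distrib    : ∀ x y z → x * (y + z) ≡ x * y + x * z
    0≢1        : 0ℝ ≢ 1ℝ
    ≤-refl    : ∀ x → x ≤ x
    ≤-trans   : ∀ {x y z} → x ≤ y → y ≤ z → x ≤ z
    ≤-antisym : ∀ {x y} → x ≤ y → y ≤ x → x ≡ y
    ≤-total   : ∀ x y → x ≤ y ⊎ y ≤ x
    +-mono-≤  : ∀ {x y} z → x ≤ y → x + z ≤ y + z
    *-nonneg  : ∀ {x y} → 0ℝ ≤ x → 0ℝ ≤ y → 0ℝ ≤ x * y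
    complete  : (P : ℝ → Set) → (∃ λ x → P x) →
                (∃ λ b → ∀ x → P x → x ≤ b) →
                ∃ λ s → (∀ x → P x → x ≤ s) ×
                        (∀ b → (∀ x → P x → x ≤ b) → s ≤ b)

module _ (R : RealField) where
  open RealField R

  In01 : ℝ → Set
  In01 x = (0ℝ ≤ x) × (x ≤ 1ℝ)

  -- binary operations on [0,1] are represented as functions ℝ → ℝ → ℝ
  -- that are only constrained on [0,1]²
  IsTNorm : (ℝ → ℝ → ℝ) → Set
  IsTNorm T =
    (∀ x y → In01 x → In01 y → In01 (T x y)) ×
    (∀ x y → In01 x → In01 y → T x y ≡ T y x) ×
    (∀ x y z → In01 x → In01 y → In01 z → T x (T y z) ≡ T (T x y) z) ×
    (∀ x x′ y → In01 x → In01 x′ → In01 y → x ≤ x′ → T x y ≤ T x′ y) ×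
    (∀ x y y′ → In01 x → In01 y → In01 y′ → y ≤ y′ → T x y ≤ T x y′) ×
    (∀ x → In01 x → T x 1ℝ ≡ x)

  IsTConorm : (ℝ → ℝ → ℝ) → Set
  IsTConorm S =
    (∀ x y → In01 x → In01 y → In01 (S x y)) ×
    (∀ x y → In01 x → In01 y → S x y ≡ S y x) ×
    (∀ x y z → In01 x → In01 y → In01 z → S x (S y z) ≡ S (S x y) z) ×
    (∀ x x′ y → In01 x → In01 x′ → In01 y → x ≤ x′ → S x y ≤ S x′ y) ×
    (∀ x y y′ → In01 x → In01 y → In01 y′ → y ≤ y′ → S x y ≤ S x y′) ×
    (∀ x → In01 x → S x 0ℝ ≡ x)

  IsFuzzyNegation : (ℝ → ℝ) → Set
  IsFuzzyNegation N =
    (∀ x → In01 x → In01 (N x)) ×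
    (∀ x y → In01 x → In01 y → x ≤ y → N y ≤ N x) ×
    (N 0ℝ ≡ 1ℝ) × (N 1ℝ ≡ 0ℝ)

  IsCrisp : (ℝ → ℝ) → Set
  IsCrisp N = ∀ x → In01 x → (N x ≡ 0ℝ) ⊎ (N x ≡ 1ℝ)

  I-SNT : (ℝ → ℝ → ℝ) → (ℝ → ℝ) → (ℝ → ℝ → ℝ) → ℝ → ℝ → ℝ
  I-SNT S N T x y = S (N (T x (N y))) (N x)

  EP : (ℝ → ℝ → ℝ) → Set
  EP I = ∀ x y z → In01 x → In01 y → In01 z → I x (I y z) ≡ I y (I x z)

  NP : (ℝ → ℝ → ℝ) → Set
  NP I = ∀ y → In01 y → I 1ℝ y ≡ y

  IP : (ℝ → ℝ → ℝ) → Set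
  IP I = ∀ x → In01 x → I x x ≡ 1ℝ

  LOP : (ℝ → ℝ → ℝ) → Set
  LOP I = ∀ x y → In01 x → In01 y → x ≤ y → I x y ≡ 1ℝ

  ROP : (ℝ → ℝ → ℝ) → Set
  ROP I = ∀ x y → In01 x → In01 y → I x y ≡ 1ℝ → x ≤ y

  OP : (ℝ → ℝ → ℝ) → Set
  OP I = LOP I × ROP I

{-# OPTIONS --safe #-}
-- Since N is crisp, I(x,y) only takes the values 0 and 1: it is 0 exactly when
-- N x = 0 and N y = 1 (then T(x, N y) = x), and 1 otherwise (S absorbs 1 and
-- T(x,0) = 0).  (EP), (IP) and (LOP) follow by case analysis on the values of N.
-- At x = 1/2, I(1,1/2) is 0 or 1, so (NP) fails, and depending on N(1/2) either
-- I(1,1/2) = 1 or I(1/2,0) = 1, so (ROP) fails.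
module Submission where

open import Defs
open import Data.Product using (_×_; _,_; proj₁; proj₂)
open import Data.Sum using (inj₁; inj₂)
open import Data.Empty using (⊥-elim)
open import Function using (_∘_)
open import Relation.Nullary using (¬_)
open import Relation.Binary.PropositionalEquality

module RealFieldProperties (R : RealField) where
  open RealField R

  +-identityˡ : ∀ x → 0ℝ + x ≡ x
  +-identityˡ x = trans (+-comm 0ℝ x) (+-identity x)

  x+y-x≡y : ∀ x y → (x + y) + (- x) ≡ y
  x+y-x≡y x y = begin
    (x + y) + - x  ≡⟨ cong (_+ - x) (+-comm x y) ⟩
    (y + x) + - x  ≡⟨ +-assoc y x (- x) ⟩
    y + (x + - x)  ≡⟨ cong (y +_) (+-inverse x) ⟩
    y + 0ℝ         ≡⟨ +-identity y ⟩
    y              ∎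
    where open ≡-Reasoning

  +-cancelˡ : ∀ x y z → x + y ≡ x + z → y ≡ z
  +-cancelˡ x y z eq =
    trans (sym (x+y-x≡y x y)) (trans (cong (_+ - x) eq) (x+y-x≡y x z))

  *-zeroʳ : ∀ x → x * 0ℝ ≡ 0ℝ
  *-zeroʳ x = sym (+-cancelˡ (x * 0ℝ) 0ℝ (x * 0ℝ) (begin
    x * 0ℝ + 0ℝ     ≡⟨ +-identity _ ⟩
    x * 0ℝ          ≡⟨ cong (x *_) (sym (+-identity 0ℝ)) ⟩
    x * (0ℝ + 0ℝ)   ≡⟨ distrib x 0ℝ 0ℝ ⟩
    x * 0ℝ + x * 0ℝ ∎))
    where open ≡-Reasoning

  -1*-1≡1 : (- 1ℝ) * (- 1ℝ) ≡ 1ℝ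
  -1*-1≡1 = +-cancelˡ (- 1ℝ) _ 1ℝ (begin
    - 1ℝ + (- 1ℝ) * (- 1ℝ)              ≡⟨ +-comm _ _ ⟩
    (- 1ℝ) * (- 1ℝ) + - 1ℝ              ≡⟨ cong ((- 1ℝ) * (- 1ℝ) +_) (sym (*-identity (- 1ℝ))) ⟩
    (- 1ℝ) * (- 1ℝ) + (- 1ℝ) * 1ℝ       ≡⟨ sym (distrib (- 1ℝ) (- 1ℝ) 1ℝ) ⟩
    (- 1ℝ) * (- 1ℝ + 1ℝ)                ≡⟨ cong ((- 1ℝ) *_) (trans (+-comm (- 1ℝ) 1ℝ) (+-inverse 1ℝ)) ⟩
    (- 1ℝ) * 0ℝ                         ≡⟨ *-zeroʳ (- 1ℝ) ⟩
    0ℝ                                  ≡⟨ sym (trans (+-comm (- 1ℝ) 1ℝ) (+-inverse 1ℝ)) ⟩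
    - 1ℝ + 1ℝ                           ∎)
    where open ≡-Reasoning

  0≤1 : 0ℝ ≤ 1ℝ
  0≤1 with ≤-total 0ℝ 1ℝ
  ... | inj₁ 0≤1 = 0≤1
  ... | inj₂ 1≤0 = subst (0ℝ ≤_) -1*-1≡1 (*-nonneg 0≤-1 0≤-1)
    where
      0≤-1 : 0ℝ ≤ - 1ℝ
      0≤-1 = subst₂ _≤_ (+-inverse 1ℝ) (+-identityˡ (- 1ℝ)) (+-mono-≤ (- 1ℝ) 1≤0)

  1≰0 : ¬ 1ℝ ≤ 0ℝ
  1≰0 = 0≢1 ∘ ≤-antisym 0≤1

  0∈[0,1] : In01 R 0ℝ
  0∈[0,1] = ≤-refl 0ℝ , 0≤1

  1∈[0,1] : In01 R 1ℝ
  1∈[0,1] = 0≤1 , ≤-refl 1ℝ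

  2ℝ : ℝ
  2ℝ = 1ℝ + 1ℝ

  2≢0 : 2ℝ ≢ 0ℝ
  2≢0 2≡0 = 1≰0 (subst₂ _≤_ (+-identityˡ 1ℝ) 2≡0 (+-mono-≤ 1ℝ 0≤1))

  ½ : ℝ
  ½ = 2ℝ ⁻¹

  ½+½≡1 : ½ + ½ ≡ 1ℝ
  ½+½≡1 = begin
    ½ + ½            ≡⟨ cong₂ _+_ (sym (*-identity ½)) (sym (*-identity ½)) ⟩
    ½ * 1ℝ + ½ * 1ℝ  ≡⟨ sym (distrib ½ 1ℝ 1ℝ) ⟩
    ½ * 2ℝ           ≡⟨ *-comm ½ 2ℝ ⟩
    2ℝ * ½           ≡⟨ *-inverse 2ℝ 2≢0 ⟩
    1ℝ               ∎
    where open ≡-Reasoning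

  0≤½ : 0ℝ ≤ ½
  0≤½ with ≤-total 0ℝ ½
  ... | inj₁ 0≤½ = 0≤½
  ... | inj₂ ½≤0 =
    ⊥-elim (1≰0 (≤-trans (subst₂ _≤_ ½+½≡1 (+-identityˡ ½) (+-mono-≤ ½ ½≤0)) ½≤0))

  ½∈[0,1] : In01 R ½
  ½∈[0,1] = 0≤½ , subst₂ _≤_ (+-identityˡ ½) ½+½≡1 (+-mono-≤ ½ 0≤½)

  ½≢0 : ½ ≢ 0ℝ
  ½≢0 ½≡0 = 0≢1 (trans (sym (+-identity 0ℝ)) (trans (cong₂ _+_ (sym ½≡0) (sym ½≡0)) ½+½≡1))

  ½≢1 : ½ ≢ 1ℝ
  ½≢1 ½≡1 = 0≢1 (sym (+-cancelˡ 1ℝ 1ℝ 0ℝ (begin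
    1ℝ + 1ℝ  ≡⟨ cong₂ _+_ (sym ½≡1) (sym ½≡1) ⟩
    ½ + ½    ≡⟨ ½+½≡1 ⟩
    1ℝ       ≡⟨ sym (+-identity 1ℝ) ⟩
    1ℝ + 0ℝ  ∎)))
    where open ≡-Reasoning

module _ (R : RealField) where
  open RealField R
  open RealFieldProperties R

  T-zeroʳ : ∀ {T} → IsTNorm R T → ∀ x → In01 R x → T x 0ℝ ≡ 0ℝ
  T-zeroʳ {T} (T-closed , T-comm , _ , T-monoˡ , _ , T-identityʳ) x x∈ = ≤-antisym
    (subst (T x 0ℝ ≤_) T[1,0]≡0 (T-monoˡ x 1ℝ 0ℝ x∈ 1∈[0,1] 0∈[0,1] (proj₂ x∈)))
    (proj₁ (T-closed x 0ℝ x∈ 0∈[0,1]))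
    where
      T[1,0]≡0 : T 1ℝ 0ℝ ≡ 0ℝ
      T[1,0]≡0 = trans (T-comm 1ℝ 0ℝ 1∈[0,1] 0∈[0,1]) (T-identityʳ 0ℝ 0∈[0,1])

  S-zeroʳ : ∀ {S} → IsTConorm R S → ∀ x → In01 R x → S x 1ℝ ≡ 1ℝ
  S-zeroʳ {S} (S-closed , S-comm , _ , S-monoˡ , _ , S-identityʳ) x x∈ = ≤-antisym
    (proj₂ (S-closed x 1ℝ x∈ 1∈[0,1]))
    (subst (_≤ S x 1ℝ) S[0,1]≡1 (S-monoˡ 0ℝ x 1ℝ 0∈[0,1] x∈ 1∈[0,1] (proj₁ x∈)))
    where
      S[0,1]≡1 : S 0ℝ 1ℝ ≡ 1ℝ
      S[0,1]≡1 = trans (S-comm 0ℝ 1ℝ 0∈[0,1] 1∈[0,1]) (S-identityʳ 1ℝ 1∈[0,1])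

module CrispImplication
  (R : RealField) (T S : RealField.ℝ R → RealField.ℝ R → RealField.ℝ R)
  (N : RealField.ℝ R → RealField.ℝ R) (isT : IsTNorm R T) (isS : IsTConorm R S)
  (isN : IsFuzzyNegation R N) (crisp : IsCrisp R N) where
  open RealField R
  open RealFieldProperties R

  I : ℝ → ℝ → ℝ
  I = I-SNT R S N T

  private
    T-closed = proj₁ isT
    T-identityʳ = proj₂ (proj₂ (proj₂ (proj₂ (proj₂ isT))))
    S-identityʳ = proj₂ (proj₂ (proj₂ (proj₂ (proj₂ isS))))
    N-closed = proj₁ isN
    N-antitone = proj₁ (proj₂ isN)
    N0≡1 = proj₁ (proj₂ (proj₂ isN))
    N1≡0 = proj₂ (proj₂ (proj₂ isN))

  Nx≡1⇒Ixy≡1 : ∀ {x y} → In01 R x → In01 R y → N x ≡ 1ℝ → I x y ≡ 1ℝ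
  Nx≡1⇒Ixy≡1 {x} {y} x∈ y∈ Nx≡1 = trans (cong (S _) Nx≡1)
    (S-zeroʳ R isS _ (N-closed _ (T-closed x (N y) x∈ (N-closed y y∈))))

  Ny≡0⇒Ixy≡1 : ∀ {x y} → In01 R x → In01 R y → N y ≡ 0ℝ → I x y ≡ 1ℝ
  Ny≡0⇒Ixy≡1 {x} {y} x∈ y∈ Ny≡0 with crisp x x∈
  ... | inj₂ Nx≡1 = Nx≡1⇒Ixy≡1 x∈ y∈ Nx≡1
  ... | inj₁ Nx≡0 = begin
    S (N (T x (N y))) (N x)  ≡⟨ cong₂ (λ a b → S (N (T x a)) b) Ny≡0 Nx≡0 ⟩
    S (N (T x 0ℝ)) 0ℝ        ≡⟨ cong (λ a → S (N a) 0ℝ) (T-zeroʳ R isT x x∈) ⟩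
    S (N 0ℝ) 0ℝ              ≡⟨ cong (λ a → S a 0ℝ) N0≡1 ⟩
    S 1ℝ 0ℝ                  ≡⟨ S-identityʳ 1ℝ 1∈[0,1] ⟩
    1ℝ                       ∎
    where open ≡-Reasoning

  Nx≡0⇒Ny≡1⇒Ixy≡0 : ∀ {x y} → In01 R x → N x ≡ 0ℝ → N y ≡ 1ℝ → I x y ≡ 0ℝ
  Nx≡0⇒Ny≡1⇒Ixy≡0 {x} {y} x∈ Nx≡0 Ny≡1 = begin
    S (N (T x (N y))) (N x)  ≡⟨ cong₂ (λ a b → S (N (T x a)) b) Ny≡1 Nx≡0 ⟩
    S (N (T x 1ℝ)) 0ℝ        ≡⟨ cong (λ a → S (N a) 0ℝ) (T-identityʳ x x∈) ⟩
    S (N x) 0ℝ               ≡⟨ cong (λ a → S a 0ℝ) Nx≡0 ⟩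
    S 0ℝ 0ℝ                  ≡⟨ S-identityʳ 0ℝ 0∈[0,1] ⟩
    0ℝ                       ∎
    where open ≡-Reasoning

  Ix1≡1 : ∀ {x} → In01 R x → I x 1ℝ ≡ 1ℝ
  Ix1≡1 x∈ = Ny≡0⇒Ixy≡1 x∈ 1∈[0,1] N1≡0

  Nz≡1⇒Iyz≡Ny : ∀ {y z} → In01 R y → In01 R z → N z ≡ 1ℝ → I y z ≡ N y
  Nz≡1⇒Iyz≡Ny y∈ z∈ Nz≡1 with crisp _ y∈
  ... | inj₁ Ny≡0 = trans (Nx≡0⇒Ny≡1⇒Ixy≡0 y∈ Ny≡0 Nz≡1) (sym Ny≡0)
  ... | inj₂ Ny≡1 = trans (Nx≡1⇒Ixy≡1 y∈ z∈ Ny≡1) (sym Ny≡1)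

  Ix[Ny]≡Iy[Nx] : ∀ {x y} → In01 R x → In01 R y → I x (N y) ≡ I y (N x)
  Ix[Ny]≡Iy[Nx] {x} {y} x∈ y∈ with crisp x x∈ | crisp y y∈
  ... | inj₂ Nx≡1 | _ = trans (Nx≡1⇒Ixy≡1 x∈ (N-closed y y∈) Nx≡1)
    (sym (Ny≡0⇒Ixy≡1 y∈ (N-closed x x∈) (trans (cong N Nx≡1) N1≡0)))
  ... | inj₁ _ | inj₂ Ny≡1 = trans (Ny≡0⇒Ixy≡1 x∈ (N-closed y y∈) (trans (cong N Ny≡1) N1≡0))
    (sym (Nx≡1⇒Ixy≡1 y∈ (N-closed x x∈) Ny≡1))
  ... | inj₁ Nx≡0 | inj₁ Ny≡0 = trans (Nx≡0⇒Ny≡1⇒Ixy≡0 x∈ Nx≡0 (trans (cong N Ny≡0) N0≡1))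
    (sym (Nx≡0⇒Ny≡1⇒Ixy≡0 y∈ Ny≡0 (trans (cong N Nx≡0) N0≡1)))

  I-exchange : EP R I
  I-exchange x y z x∈ y∈ z∈ with crisp z z∈
  ... | inj₁ Nz≡0 = begin
    I x (I y z)  ≡⟨ cong (I x) (Ny≡0⇒Ixy≡1 y∈ z∈ Nz≡0) ⟩
    I x 1ℝ       ≡⟨ Ix1≡1 x∈ ⟩
    1ℝ           ≡⟨ sym (Ix1≡1 y∈) ⟩
    I y 1ℝ       ≡⟨ cong (I y) (sym (Ny≡0⇒Ixy≡1 x∈ z∈ Nz≡0)) ⟩
    I y (I x z)  ∎
    where open ≡-Reasoning
  ... | inj₂ Nz≡1 = begin
    I x (I y z)  ≡⟨ cong (I x) (Nz≡1⇒Iyz≡Ny y∈ z∈ Nz≡1) ⟩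
    I x (N y)    ≡⟨ Ix[Ny]≡Iy[Nx] x∈ y∈ ⟩
    I y (N x)    ≡⟨ cong (I y) (sym (Nz≡1⇒Iyz≡Ny x∈ z∈ Nz≡1)) ⟩
    I y (I x z)  ∎
    where open ≡-Reasoning

  I-identity : IP R I
  I-identity x x∈ with crisp x x∈
  ... | inj₁ Nx≡0 = Ny≡0⇒Ixy≡1 x∈ x∈ Nx≡0
  ... | inj₂ Nx≡1 = Nx≡1⇒Ixy≡1 x∈ x∈ Nx≡1

  I-leftOrdering : LOP R I
  I-leftOrdering x y x∈ y∈ x≤y with crisp x x∈
  ... | inj₂ Nx≡1 = Nx≡1⇒Ixy≡1 x∈ y∈ Nx≡1
  ... | inj₁ Nx≡0 = Ny≡0⇒Ixy≡1 x∈ y∈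
    (≤-antisym (subst (N y ≤_) Nx≡0 (N-antitone x y x∈ y∈ x≤y)) (proj₁ (N-closed y y∈)))

  I-¬neutrality : ¬ NP R I
  I-¬neutrality np with crisp ½ ½∈[0,1]
  ... | inj₁ N½≡0 = ½≢1 (trans (sym (np ½ ½∈[0,1])) (Ny≡0⇒Ixy≡1 1∈[0,1] ½∈[0,1] N½≡0))
  ... | inj₂ N½≡1 = ½≢0 (trans (sym (np ½ ½∈[0,1])) (Nx≡0⇒Ny≡1⇒Ixy≡0 1∈[0,1] N1≡0 N½≡1))

  I-¬rightOrdering : ¬ ROP R I
  I-¬rightOrdering rop with crisp ½ ½∈[0,1]
  ... | inj₁ N½≡0 = ½≢1 (≤-antisym (proj₂ ½∈[0,1])
    (rop 1ℝ ½ 1∈[0,1] ½∈[0,1] (Ny≡0⇒Ixy≡1 1∈[0,1] ½∈[0,1] N½≡0)))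
  ... | inj₂ N½≡1 = ½≢0 (≤-antisym
    (rop ½ 0ℝ ½∈[0,1] 0∈[0,1] (Nx≡1⇒Ixy≡1 ½∈[0,1] 0∈[0,1] N½≡1)) (proj₁ ½∈[0,1]))

mainTheorem3 : (R : RealField) →
    (T S : RealField.ℝ R → RealField.ℝ R → RealField.ℝ R) →
    (N : RealField.ℝ R → RealField.ℝ R) →
    IsTNorm R T → IsTConorm R S →
    IsFuzzyNegation R N → IsCrisp R N →
    EP R (I-SNT R S N T) × ¬ NP R (I-SNT R S N T) × IP R (I-SNT R S N T) ×
    LOP R (I-SNT R S N T) × ¬ ROP R (I-SNT R S N T) × ¬ OP R (I-SNT R S N T)
mainTheorem3 R T S N isT isS isN crisp =
  I-exchange , I-¬neutrality , I-identity , I-leftOrdering , I-¬rightOrdering ,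
  I-¬rightOrdering ∘ proj₂
  where open CrispImplication R T S N isT isS isN crisp
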